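{- Let $\mathcal{G}=(\mathcal{V},\mathit{Act},\mathcal{R})$ be a normed BPA system with no silent variables, and let $\mathcal{B}$ be a consistent base for $\mathcal{G}$. Then the relation $\equiv^{\mathcal{B}}$ on $\mathcal{V}^*$, defined by $\alpha\equiv^{\mathcal{B}}\beta$ iff $\mathrm{PD}^{\mathcal{B}}_{\emptyset}(\alpha)=\mathrm{PD}^{\mathcal{B}}_{\emptyset}(\beta)$, is a branching bisimulation on the LTS of $\mathcal{G}$.
   Context: Branching bisimulation on an LTS (with silent action $\tau$): a symmetric relation $\mathcal{B}'$ such that for every $(s,t)\in\mathcal{B}'$ and $s\xrightarrow{a}s'$, either $a=\tau$ and $(s',t)\in\mathcal{B}'$, or there are $k\ge0$ and $t=t_0\xrightarrow{\tau}\cdots\xrightarrow{\tau}t_k\xrightarrow{a}t'$ with $(s',t')\in\mathcal{B}'$ and $(s,t_i)\in\mathcal{B}'$ for $1\le i\le k$. A BPA system $\mathcal{G}=(\mathcal{V},\mathit{Act},\mathcal{R})$: finite variables $\mathcal{V}$, finite actions $\mathit{Act}$ (possibly containing $\tau$), finite rules $A\xrightarrow{a}\alpha$; its LTS has states $\mathcal{V}^*$ and transitions $A\beta\xrightarrow{a}\alpha\beta$ for each rule and each $\beta$; normed means every variable $A$ has $A\xrightarrow{w}\varepsilon$ for some $w$; a variable $A$ is silent if $A\xrightarrow{w}\alpha$ implies $w\in\{\tau\}^*$; $\|A\|$ is the length of a shortest $w$ with $A\xrightarrow{w}\varepsilon$. Pre-base: domain $\mathrm{dom}(\mathcal{B})\subseteq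 2^{\mathcal{V}}$ with $\emptyset\in\mathrm{dom}(\mathcal{B})$, and disjoint sets $\mathcal{B}_{dec},\mathcal{B}_{prop}$ of triples $(A,\alpha,R)$ such that: (1) for each $R\in\mathrm{dom}(\mathcal{B})$, $\mathcal{V}\setminus R$ is partitioned into $(\mathcal{B},R)$-primes and $(\mathcal{B},R)$-non-primes; each $(\mathcal{B},R)$-non-prime $A$ has exactly one triple $(A,\alpha,R)\in\mathcal{B}_{dec}$, with $\alpha=\beta B$ for a $(\mathcal{B},R)$-prime $B$; each $(\mathcal{B},R)$-prime $B$ may have triples $(B,XB,R)\in\mathcal{B}_{prop}$, and $\mathrm{Red}^{\mathcal{B}}(B,R)=\{X\mid (B,XB,R)\in\mathcal{B}_{prop}\}$; (2) no other triples; (3) $\mathrm{dom}(\mathcal{B})$ is the least set containing $\emptyset$ and closed under $R\mapsto\mathrm{Red}^{\mathcal{B}}(B,R)$ for $(\mathcal{B},R)$-primes $B$. $\mathrm{PD}^{\mathcal{B}}_R$: $\mathrm{PD}^{\mathcal{B}}_R(\varepsilon)=\varepsilon$; $\mathrm{PD}^{\mathcal{B}}_R(\beta A)=\mathrm{PD}^{\mathcal{B}}_R(\beta)$ if $A\in R$; $=\mathrm{PD}^{\mathcal{B}}_{R'}(\beta)A$ with $R'=\mathrm{Red}^{\mathcal{B}}(A,R)$ if $A$ is a $(\mathcal{B},R)$-prime; $=\mathrm{PD}^{\mathcal{B}}_R(\beta\alpha)$ with $(A,\alpha,R)\in\mathcal{B}_{dec}$ if $A$ is a $(\mathcal{B},R)$-non-prime.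 A base is a pre-base with $|\mathrm{PD}^{\mathcal{B}}_R(A)|\le\|A\|$ for all $A$ and $R\in\mathrm{dom}(\mathcal{B})$, and $\alpha=\mathrm{PD}^{\mathcal{B}}_R(\alpha)$ for each $(A,\alpha,R)\in\mathcal{B}_{dec}$. $\alpha\equiv^{\mathcal{B}}_R\beta$ iff $\mathrm{PD}^{\mathcal{B}}_R(\alpha)=\mathrm{PD}^{\mathcal{B}}_R(\beta)$. Legal outcomes: $(a,\alpha')\in\mathrm{LM}^{\mathcal{B}}_R(\alpha)$ iff either $a=\tau$ and $\alpha'=\mathrm{PD}^{\mathcal{B}}_R(\alpha)$, or there is a path $\alpha=\alpha_0\xrightarrow{\tau}\cdots\xrightarrow{\tau}\alpha_k\xrightarrow{a}\alpha''$ ($k\ge0$) with $\alpha'=\mathrm{PD}^{\mathcal{B}}_R(\alpha'')$ and $\mathrm{PD}^{\mathcal{B}}_R(\alpha_i)=\mathrm{PD}^{\mathcal{B}}_R(\alpha)$ for $1\le i\le k$. A base is consistent if for every triple $(A,\alpha,R)\in\mathcal{B}_{dec}\cup\mathcal{B}_{prop}$ we have $A\equiv^{\mathcal{B}}_R\alpha$ and $\mathrm{LM}^{\mathcal{B}}_R(A)=\mathrm{LM}^{\mathcal{B}}_R(\alpha)$. -}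

module Defs where

open import Data.Nat using (ℕ; _≤_)
open import Data.Fin using (Fin)
open import Data.Maybe using (Maybe; nothing; just)
open import Data.Bool using (Bool; true; false)
open import Data.List using (List; []; _∷_; _++_; _∷ʳ_; length)
open import Data.List.Relation.Unary.All using (All)
open import Data.List.Membership.Propositional using () renaming (_∈_ to _∈ₗ_)
open import Data.Fin.Subset using (Subset; _∈_; _∉_) renaming (⊥ to ∅)
open import Data.Product using (Σ; ∃; ∃₂; _×_; _,_)
open import Data.Sum using (_⊎_)
open import Relation.Nullary using (¬_)
open import Relation.Binary.PropositionalEquality using (_≡_)
open import Function.Bundles using (_⇔_)

Label : ℕ → Set
Label m = Maybe (Fin m)

τ : ∀ {m} → Label m
τ = nothing

-- A BPA system with variables Fin n and visible actions Fin m.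
-- A rule  (A , a , α)  stands for  A --a--> α .
record BPA (n m : ℕ) : Set where
  field
    rules : List (Fin n × Label m × List (Fin n))

open BPA public

module _ {n m : ℕ} (G : BPA n m) where

  data Step : List (Fin n) → Label m → List (Fin n) → Set where
    step : ∀ {A a α β} → (A , a , α) ∈ₗ rules G → Step (A ∷ β) a (α ++ β)

  data Steps : List (Fin n) → List (Label m) → List (Fin n) → Set where
    done : ∀ {α} → Steps α [] α
    more : ∀ {α a α' w α''} → Step α a α' → Steps α' w α'' → Steps α (a ∷ w) α''

  Normed : Set
  Normed = ∀ (A : Fin n) → ∃ λ w → Steps (A ∷ []) w []

  Silent : Fin n → Set
  Silent A = ∀ w α → Steps (A ∷ []) w α → All (_≡ τ) w

  NoSilentVariables : Set
  NoSilentVariables = ∀ (A : Fin n) → ¬ Silent A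

  IsNorm : Fin n → ℕ → Set
  IsNorm A k = (∃ λ w → Steps (A ∷ []) w [] × length w ≡ k)
             × (∀ w → Steps (A ∷ []) w [] → k ≤ length w)

  module _ (Rel : List (Fin n) → List (Fin n) → Set) where

    data TauPath (s : List (Fin n)) (t : List (Fin n)) : List (Fin n) → Set where
      here  : TauPath s t t
      there : ∀ {u u'} → TauPath s t u → Step u τ u' → Rel s u' → TauPath s t u'

    IsBranchingBisimulation : Set
    IsBranchingBisimulation =
      (∀ s t → Rel s t → Rel t s) ×
      (∀ s t → Rel s t → ∀ a s' → Step s a s' →
         (a ≡ τ × Rel s' t) ⊎
         (∃₂ λ tk t' → TauPath s t tk × Step tk a t' × Rel s' t'))

Triple : ℕ → Set
Triple n = Fin n × List (Fin n) × Subset n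

-- The data of a pre-base: the prime/non-prime partition (for each R,
-- the (B,R)-primes among V∖R are those with isPrime R A ≡ true), and the
-- finite sets B_dec, B_prop.  dom(B) is then determined by condition (3)
-- and is defined inductively below as the least such set.
record PreBaseData (n : ℕ) : Set where
  field
    isPrime : Subset n → Fin n → Bool
    Bdec    : List (Triple n)
    Bprop   : List (Triple n)

open PreBaseData public

module _ {n : ℕ} (D : PreBaseData n) where

  Prime : Subset n → Fin n → Set
  Prime R A = A ∉ R × isPrime D R A ≡ true

  NonPrime : Subset n → Fin n → Set
  NonPrime R A = A ∉ R × isPrime D R A ≡ false

  IsRed : Fin n → Subset n → Subset n → Set
  IsRed B R R' = ∀ X → (X ∈ R') ⇔ ((B , X ∷ B ∷ [] , R) ∈ₗ Bprop D)

  data Dom : Subset n → Set where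
    dom-∅   : Dom ∅
    dom-red : ∀ {R B R'} → Dom R → Prime R B → IsRed B R R' → Dom R'

  IsPreBase : Set
  IsPreBase =
    (∀ t → t ∈ₗ Bdec D → ¬ (t ∈ₗ Bprop D)) ×
    (∀ R → Dom R → ∀ A → NonPrime R A →
       ∃ λ α → (A , α , R) ∈ₗ Bdec D × (∀ α' → (A , α' , R) ∈ₗ Bdec D → α' ≡ α)) ×
    (∀ A α R → (A , α , R) ∈ₗ Bdec D →
       Dom R × NonPrime R A × (∃₂ λ β B → α ≡ β ∷ʳ B × Prime R B)) ×
    (∀ B α R → (B , α , R) ∈ₗ Bprop D →
       Dom R × Prime R B × (∃ λ X → α ≡ X ∷ B ∷ []))

  -- PD R α γ  :  PD^B_R(α) = γ   (the recursive definition, as a relation)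
  data PD : Subset n → List (Fin n) → List (Fin n) → Set where
    pd-ε     : ∀ {R} → PD R [] []
    pd-in    : ∀ {R β A γ} → A ∈ R → PD R β γ → PD R (β ∷ʳ A) γ
    pd-prime : ∀ {R β A R' γ} → Prime R A → IsRed A R R' →
               PD R' β γ → PD R (β ∷ʳ A) (γ ∷ʳ A)
    pd-dec   : ∀ {R β A α γ} → NonPrime R A → (A , α , R) ∈ₗ Bdec D →
               PD R (β ++ α) γ → PD R (β ∷ʳ A) γ

  Equiv : Subset n → List (Fin n) → List (Fin n) → Set
  Equiv R α β = ∃ λ γ → PD R α γ × PD R β γ

module _ {n m : ℕ} (G : BPA n m) (D : PreBaseData n) where

  IsBase : Set
  IsBase =
    IsPreBase D ×
    (∀ R → Dom D R → ∀ A → ∃ λ γ → PD D R (A ∷ []) γ ×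
        (∀ k → IsNorm G A k → length γ ≤ k)) ×
    (∀ A α R → (A , α , R) ∈ₗ Bdec D → PD D R α α)

  data PresPath (R : Subset n) (α : List (Fin n)) : List (Fin n) → Set where
    here  : PresPath R α α
    there : ∀ {u u'} → PresPath R α u → Step G u τ u' → Equiv D R u' α →
            PresPath R α u'

  LM : Subset n → List (Fin n) → Label m → List (Fin n) → Set
  LM R α a α' =
    (a ≡ τ × PD D R α α') ⊎
    (∃₂ λ αk α'' → PresPath R α αk × Step G αk a α'' × PD D R α'' α')

  Consistent : Set
  Consistent = ∀ A α R → (A , α , R) ∈ₗ (Bdec D ++ Bprop D) →
    Equiv D R (A ∷ []) α × (∀ a α' → LM R (A ∷ []) a α' ⇔ LM R α a α')

  EquivB : List (Fin n) → List (Fin n) → Set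
  EquivB = Equiv D ∅

-- The key fact is that, for R ∈ dom(B) and PD_R(α) ≠ ε, the legal outcomes of α and
-- of PD_R(α) coincide.  It is proved along the computation of PD_R(α): each
-- step replaces a suffix of the word (a variable of R is dropped, a non-prime is replaced
-- by its decomposition, variables of Red(A,R) in front of a prime A are erased, or the
-- computation continues left of a prime under Red(A,R)), consistency of the base says
-- that the replaced single variable and its replacement have the same legal outcomes,
-- and a congruence argument extends this to every prefix, because a PD-preserving
-- τ-path either only rewrites the prefix or consumes it completely.  Then, if
-- PD(s) = PD(t) and s -a-> s', the outcome (a, PD(s')) is legal for s, hence for PD(s),
-- hence for t, which is the transfer condition of a branching bisimulation.
module Submission where

open import Defs
open import Data.Bool using (true; false)
open import Data.Bool.Properties using (T-≡) renaming (_≟_ to _≟ᵇ_)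
open import Data.Empty using (⊥-elim)
open import Data.Fin using (Fin) renaming (_≟_ to _≟ᶠ_)
open import Data.Fin.Subset using (Subset; _∈_) renaming (⊥ to ∅)
open import Data.Fin.Subset.Properties using (⊆-antisym; ∉⊥) renaming (_∈?_ to _∈ˢ?_)
open import Data.Nat using (ℕ)
open import Data.List using (List; []; _∷_; _++_; _∷ʳ_; [_])
open import Data.List.Properties
  using (++-assoc; ++-identityʳ; ++-conicalʳ; ∷ʳ-injective; ∷ʳ-injectiveˡ; ∷ʳ-++)
  renaming (≡-dec to ≡-decᴸ)
open import Data.List.Reverse using (Reverse; []; _∶_∶ʳ_; reverseView)
open import Data.List.Relation.Unary.All using (All; []; _∷_)
open import Data.List.Relation.Unary.All.Properties using (++⁻ʳ; ∷ʳ⁺; ∷ʳ⁻)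
open import Data.List.Membership.Propositional using () renaming (_∈_ to _∈ₗ_)
open import Data.List.Membership.Propositional.Properties using (∈-++⁺ˡ; ∈-++⁺ʳ)
open import Data.Product using (∃; ∃₂; _×_; _,_; proj₁; proj₂)
open import Data.Product.Properties using () renaming (≡-dec to ≡-decˣ)
open import Data.Sum using (_⊎_; inj₁; inj₂)
open import Data.Vec using (tabulate)
open import Data.Vec.Properties using (lookup∘tabulate; []=⇒lookup; lookup⇒[]=)
  renaming (≡-dec to ≡-decⱽ)
open import Function using (_∘_; id)
open import Function.Bundles using (Equivalence; mk⇔)
open import Relation.Binary.Definitions using (DecidableEquality)
open import Relation.Binary.PropositionalEquality
  using (_≡_; _≢_; refl; sym; trans; cong; subst)
open import Relation.Nullary using (¬_; yes; no)
open import Relation.Nullary.Decidable using (isYes; toWitness; fromWitness)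

Word : ℕ → Set
Word n = List (Fin n)

∷ʳ≢[] : ∀ {A : Set} (xs : List A) {x : A} → xs ∷ʳ x ≢ []
∷ʳ≢[] xs {x} eq with () ← ++-conicalʳ xs [ x ] eq

module _ {n m} (G : BPA n m) where

  Step-++ʳ : ∀ {α a α'} γ → Step G α a α' → Step G (α ++ γ) a (α' ++ γ)
  Step-++ʳ γ (step {α = α} {β = β} r) = subst (Step G _ _) (sym (++-assoc α β γ)) (step r)

  Step-++⁻ : ∀ {a α'} α γ → α ≢ [] → Step G (α ++ γ) a α' →
             ∃ λ α₀ → α' ≡ α₀ ++ γ × Step G α a α₀
  Step-++⁻ []      γ α≢[] _                = ⊥-elim (α≢[] refl)
  Step-++⁻ (A ∷ β) γ _    (step {α = α} r) = α ++ β , sym (++-assoc α β γ) , step r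

module PD-Properties {n} (D : PreBaseData n) where

  Prime⇒¬NonPrime : ∀ {R A} → Prime D R A → ¬ NonPrime D R A
  Prime⇒¬NonPrime (_ , isP) (_ , isNP) with () ← trans (sym isP) isNP

  IsRed-unique : ∀ {B R R₁ R₂} → IsRed D B R R₁ → IsRed D B R R₂ → R₁ ≡ R₂
  IsRed-unique r₁ r₂ = ⊆-antisym (Equivalence.from (r₂ _) ∘ Equivalence.to (r₁ _))
                                 (Equivalence.from (r₁ _) ∘ Equivalence.to (r₂ _))

  PD-subst : ∀ {R α α' γ} → α ≡ α' → PD D R α γ → PD D R α' γ
  PD-subst refl d = d

  PD-[] : ∀ {R γ} → PD D R [] γ → γ ≡ []
  PD-[] d = go d refl
    where
      go : ∀ {R α γ} → PD D R α γ → α ≡ [] → γ ≡ []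
      go pd-ε                        _  = refl
      go (pd-in    {β = β} _ _)     eq = ⊥-elim (∷ʳ≢[] β eq)
      go (pd-prime {β = β} _ _ _)   eq = ⊥-elim (∷ʳ≢[] β eq)
      go (pd-dec   {β = β} _ _ _)   eq = ⊥-elim (∷ʳ≢[] β eq)

  data PD-∷ʳ-View (R : Subset n) (β : Word n) (A : Fin n) (γ : Word n) : Set where
    in-R      : A ∈ R → PD D R β γ → PD-∷ʳ-View R β A γ
    prime     : ∀ {R' γ'} → Prime D R A → IsRed D A R R' → PD D R' β γ' → γ ≡ γ' ∷ʳ A →
                PD-∷ʳ-View R β A γ
    non-prime : ∀ {δ} → NonPrime D R A → (A , δ , R) ∈ₗ Bdec D → PD D R (β ++ δ) γ →
                PD-∷ʳ-View R β A γ

  PD-∷ʳ-view : ∀ {R γ} β A → PD D R (β ∷ʳ A) γ → PD-∷ʳ-View R β A γ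
  PD-∷ʳ-view β A d = view d refl
    where
      view : ∀ {R α γ} → PD D R α γ → α ≡ β ∷ʳ A → PD-∷ʳ-View R β A γ
      view pd-ε eq = ⊥-elim (∷ʳ≢[] β (sym eq))
      view (pd-in {β = β'} a d) eq with refl , refl ← ∷ʳ-injective β' β eq = in-R a d
      view (pd-prime {β = β'} p r d) eq with refl , refl ← ∷ʳ-injective β' β eq = prime p r d refl
      view (pd-dec {β = β'} np t d) eq with refl , refl ← ∷ʳ-injective β' β eq = non-prime np t d

  PD-∷ʳ-∈⁻ : ∀ {R A γ} β → A ∈ R → PD D R (β ∷ʳ A) γ → PD D R β γ
  PD-∷ʳ-∈⁻ β a d with PD-∷ʳ-view β _ d
  ... | in-R _ d'        = d'
  ... | prime p _ _ _    = ⊥-elim (proj₁ p a)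
  ... | non-prime np _ _ = ⊥-elim (proj₁ np a)

  PD-∷ʳ-prime⁻ : ∀ {R R' A β γ} → Prime D R A → IsRed D A R R' → PD D R (β ∷ʳ A) γ →
                 ∃ λ γ' → γ ≡ γ' ∷ʳ A × PD D R' β γ'
  PD-∷ʳ-prime⁻ {A = A} {β = β} p r d with PD-∷ʳ-view β A d
  ... | in-R a _           = ⊥-elim (proj₁ p a)
  ... | prime _ r' d' refl = _ , refl , subst (λ R' → PD D R' β _) (IsRed-unique r' r) d'
  ... | non-prime np _ _   = ⊥-elim (Prime⇒¬NonPrime p np)

  PD-++-∈⁻ : ∀ {R ys γ} → All (_∈ R) ys → ∀ xs → PD D R (xs ++ ys) γ → PD D R xs γ
  PD-++-∈⁻ []             xs d = PD-subst (++-identityʳ xs) d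
  PD-++-∈⁻ (y∈R ∷ ys⊆R) xs d =
    PD-∷ʳ-∈⁻ xs y∈R (PD-++-∈⁻ ys⊆R (xs ∷ʳ _) (PD-subst (sym (∷ʳ-++ xs _ _)) d))

  PD-++-∈⁺ : ∀ {R ys γ} → All (_∈ R) ys → ∀ xs → PD D R xs γ → PD D R (xs ++ ys) γ
  PD-++-∈⁺ []             xs d = PD-subst (sym (++-identityʳ xs)) d
  PD-++-∈⁺ (y∈R ∷ ys⊆R) xs d = PD-subst (∷ʳ-++ xs _ _) (PD-++-∈⁺ ys⊆R (xs ∷ʳ _) (pd-in y∈R d))

  PD-idem : ∀ {R α γ} → PD D R α γ → PD D R γ γ
  PD-idem pd-ε             = pd-ε
  PD-idem (pd-in _ d)      = PD-idem d
  PD-idem (pd-prime p r d) = pd-prime p r (PD-idem d)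
  PD-idem (pd-dec _ _ d)   = PD-idem d

  Equiv-sym : ∀ {R α β} → Equiv D R α β → Equiv D R β α
  Equiv-sym (γ , dα , dβ) = γ , dβ , dα

module PD-Functional {n} {D : PreBaseData n} (pre : IsPreBase D) where
  open PD-Properties D

  Bdec-unique : ∀ {R A δ₁ δ₂} → Dom D R → NonPrime D R A →
                (A , δ₁ , R) ∈ₗ Bdec D → (A , δ₂ , R) ∈ₗ Bdec D → δ₁ ≡ δ₂
  Bdec-unique dR np t₁ t₂ with _ , _ , unique ← proj₁ (proj₂ pre) _ dR _ np =
    trans (unique _ t₁) (sym (unique _ t₂))

  PD-∷ʳ-nonPrime⁻ : ∀ {R A δ β γ} → Dom D R → NonPrime D R A → (A , δ , R) ∈ₗ Bdec D →
                    PD D R (β ∷ʳ A) γ → PD D R (β ++ δ) γ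
  PD-∷ʳ-nonPrime⁻ {A = A} {β = β} dR np t d with PD-∷ʳ-view β A d
  ... | in-R a _         = ⊥-elim (proj₁ np a)
  ... | prime p _ _ _    = ⊥-elim (Prime⇒¬NonPrime p np)
  ... | non-prime _ t' d' with refl ← Bdec-unique dR np t t' = d'

  PD-functional : ∀ {R α γ₁ γ₂} → Dom D R → PD D R α γ₁ → PD D R α γ₂ → γ₁ ≡ γ₂
  PD-functional dR pd-ε              d₂ = sym (PD-[] d₂)
  PD-functional dR (pd-in a d)       d₂ = PD-functional dR d (PD-∷ʳ-∈⁻ _ a d₂)
  PD-functional dR (pd-prime p r d)  d₂ with _ , refl , d' ← PD-∷ʳ-prime⁻ p r d₂ =
    cong (_∷ʳ _) (PD-functional (dom-red dR p r) d d')
  PD-functional dR (pd-dec np t d)   d₂ = PD-functional dR d (PD-∷ʳ-nonPrime⁻ dR np t d₂)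

  PD≡[]⇒All∈ : ∀ {R α γ} → PD D R α γ → γ ≡ [] → All (_∈ R) α
  PD≡[]⇒All∈ pd-ε                    _  = []
  PD≡[]⇒All∈ (pd-in a d)             eq = ∷ʳ⁺ (PD≡[]⇒All∈ d eq) a
  PD≡[]⇒All∈ (pd-prime {γ = γ} _ _ _) eq = ⊥-elim (∷ʳ≢[] γ eq)
  PD≡[]⇒All∈ (pd-dec {β = β} _ t d)   eq
    with _ , _ , _ , _ , refl , p ← proj₁ (proj₂ (proj₂ pre)) _ _ _ t =
    ⊥-elim (proj₁ p (proj₂ (∷ʳ⁻ (++⁻ʳ β (PD≡[]⇒All∈ d eq)))))

  Equiv-trans : ∀ {R α β γ} → Dom D R → Equiv D R α β → Equiv D R β γ → Equiv D R α γ
  Equiv-trans dR (η , dα , dβ) (η' , dβ' , dγ) with refl ← PD-functional dR dβ dβ' = η , dα , dγ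

module PD-Total {n} {D : PreBaseData n} (pre : IsPreBase D)
                (Bdec-fixed : ∀ A α R → (A , α , R) ∈ₗ Bdec D → PD D R α α) where
  open PD-Properties D
  open PD-Functional pre

  _≟ᵗ_ : DecidableEquality (Triple n)
  _≟ᵗ_ = ≡-decˣ _≟ᶠ_ (≡-decˣ (≡-decᴸ _≟ᶠ_) (≡-decⱽ _≟ᵇ_))

  open import Data.List.Membership.DecPropositional _≟ᵗ_ using () renaming (_∈?_ to _∈ᵗ?_)

  red : Fin n → Subset n → Subset n
  red B R = tabulate λ X → isYes ((B , X ∷ B ∷ [] , R) ∈ᵗ? Bprop D)

  red-IsRed : ∀ B R → IsRed D B R (red B R)
  red-IsRed B R X = mk⇔
    (λ X∈red → toWitness (Equivalence.from T-≡ (trans (sym (lookup∘tabulate _ X)) ([]=⇒lookup X∈red))))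
    (λ t → lookup⇒[]= X _ (trans (lookup∘tabulate _ X) (Equivalence.to T-≡ (fromWitness t))))

  Total : Word n → Set
  Total α = ∀ {R} → Dom D R → ∃ (PD D R α)

  PD-++-total : ∀ {β} → Total β → ∀ {R δ γ} → Dom D R → PD D R δ γ → ∃ (PD D R (β ++ δ))
  PD-++-total {β} total-β dR pd-ε =
    let η , d = total-β dR in η , PD-subst (sym (++-identityʳ β)) d
  PD-++-total {β} total-β dR (pd-in {β = δ} a d) =
    let η , d' = PD-++-total total-β dR d in
    η , PD-subst (++-assoc β δ _) (pd-in a d')
  PD-++-total {β} total-β dR (pd-prime {β = δ} p r d) =
    let η , d' = PD-++-total total-β (dom-red dR p r) d in
    η ∷ʳ _ , PD-subst (++-assoc β δ _) (pd-prime p r d')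
  PD-++-total {β} total-β dR (pd-dec {β = δ} {α = δ'} np t d) =
    let η , d' = PD-++-total total-β dR d in
    η , PD-subst (++-assoc β δ _) (pd-dec np t (PD-subst (sym (++-assoc β δ δ')) d'))

  -- A non-prime A is replaced by its decomposition δ, and β δ is no shorter than β A;
  -- PD of β δ is instead obtained from the fixed point PD_R(δ) = δ, so recursion is on β only.
  PD-total-reverse : ∀ {α} → Reverse α → Total α
  PD-total-reverse [] dR = [] , pd-ε
  PD-total-reverse (β ∶ rβ ∶ʳ A) {R} dR with A ∈ˢ? R
  ... | yes A∈R =
    let η , d = PD-total-reverse rβ dR in η , pd-in A∈R d
  ... | no A∉R with isPrime D R A in isP
  ...   | true =
    let η , d = PD-total-reverse rβ (dom-red dR (A∉R , isP) (red-IsRed A R)) in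
    η ∷ʳ A , pd-prime (A∉R , isP) (red-IsRed A R) d
  ...   | false with δ , t , _ ← proj₁ (proj₂ pre) R dR A (A∉R , isP) =
    let η , d = PD-++-total (PD-total-reverse rβ) dR (Bdec-fixed A δ R t) in
    η , pd-dec (A∉R , isP) t d

  PD-total : ∀ {R} → Dom D R → ∀ α → ∃ (PD D R α)
  PD-total dR α = PD-total-reverse (reverseView α) dR

  Equiv-refl : ∀ {R} → Dom D R → ∀ α → Equiv D R α α
  Equiv-refl dR α = let γ , d = PD-total dR α in γ , d , d

module LM-Properties {n m} (G : BPA n m) {D : PreBaseData n} (pre : IsPreBase D)
                     (Bdec-fixed : ∀ A α R → (A , α , R) ∈ₗ Bdec D → PD D R α α) where
  open PD-Properties D
  open PD-Functional pre
  open PD-Total pre Bdec-fixed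

  LM-⊆ : Subset n → Word n → Word n → Set
  LM-⊆ R α β = ∀ {a α'} → LM G D R α a α' → LM G D R β a α'

  LM-≈ : Subset n → Word n → Word n → Set
  LM-≈ R α β = LM-⊆ R α β × LM-⊆ R β α

  LM-≈-sym : ∀ {R α β} → LM-≈ R α β → LM-≈ R β α
  LM-≈-sym (α⊆β , β⊆α) = β⊆α , α⊆β

  LM-≈-trans : ∀ {R α β γ} → LM-≈ R α β → LM-≈ R β γ → LM-≈ R α γ
  LM-≈-trans (α⊆β , β⊆α) (β⊆γ , γ⊆β) = β⊆γ ∘ α⊆β , β⊆α ∘ γ⊆β

  PresPath-++ : ∀ {R α β γ} → Dom D R → PresPath G D R α β → Equiv D R β α →
                PresPath G D R β γ → PresPath G D R α γ
  PresPath-++ dR p e here             = p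
  PresPath-++ dR p e (there q st e') = there (PresPath-++ dR p e q) st (Equiv-trans dR e' e)

  LM-⊆-reachable : ∀ {R α β} → Dom D R → PresPath G D R α β → Equiv D R β α → LM-⊆ R β α
  LM-⊆-reachable dR p (γ , dβ , dα) (inj₁ (refl , d)) with refl ← PD-functional dR d dβ =
    inj₁ (refl , dα)
  LM-⊆-reachable dR p e (inj₂ (u , α'' , q , st , d)) =
    inj₂ (u , α'' , PresPath-++ dR p e q , st , d)

  SuffixReplaceable : Subset n → Word n → Word n → Set
  SuffixReplaceable R y z = ∀ x {η} → PD D R (x ++ y) η → PD D R (x ++ z) η

  module _ {R} (dR : Dom D R) (x : Word n) {y z : Word n}
           (y⇒z : SuffixReplaceable R y z)
           (LM-y⊆z : Equiv D R y (x ++ y) → LM-⊆ R y z) where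

    private
      Equiv-replace : ∀ x' → Equiv D R (x' ++ y) (x ++ y) → Equiv D R (x' ++ z) (x ++ z)
      Equiv-replace x' (γ , d , d') = γ , y⇒z x' d , y⇒z x d'

      -- A PD-preserving τ-path from x ++ y either only rewrites the prefix x,
      -- or at some point consumes it entirely and continues from y.
      data PathSplit (u : Word n) : Set where
        in-prefix : ∀ x' → u ≡ x' ++ y → Equiv D R (x' ++ y) (x ++ y) →
                    PresPath G D R (x ++ z) (x' ++ z) → PathSplit u
        in-suffix : PresPath G D R y u → Equiv D R y (x ++ y) →
                    PresPath G D R (x ++ z) z → PathSplit u

      split : ∀ {u} → PresPath G D R (x ++ y) u → PathSplit u
      split here = in-prefix x refl (Equiv-refl dR _) here
      split (there p st e) with split p
      ... | in-suffix py e₀ q = in-suffix (there py st (Equiv-trans dR e (Equiv-sym e₀))) e₀ q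
      ... | in-prefix [] refl e₀ q =
        in-suffix (there here st (Equiv-trans dR e (Equiv-sym e₀))) e₀ q
      ... | in-prefix (B ∷ β) refl _ q with x'' , refl , st' ← Step-++⁻ G (B ∷ β) y (λ ()) st =
        in-prefix x'' refl e (there q (Step-++ʳ G z st') (Equiv-replace x'' e))

      LM-⊆-through-y : Equiv D R y (x ++ y) → PresPath G D R (x ++ z) z → LM-⊆ R y (x ++ z)
      LM-⊆-through-y e q = LM-⊆-reachable dR q (Equiv-replace [] e) ∘ LM-y⊆z e

    LM-⊆-++ˡ : LM-⊆ R (x ++ y) (x ++ z)
    LM-⊆-++ˡ (inj₁ (refl , d)) = inj₁ (refl , y⇒z x d)
    LM-⊆-++ˡ (inj₂ (u , α'' , p , st , d)) with split p
    ... | in-suffix py e q = LM-⊆-through-y e q (inj₂ (u , α'' , py , st , d))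
    ... | in-prefix [] refl e q = LM-⊆-through-y e q (inj₂ (y , α'' , here , st , d))
    ... | in-prefix (B ∷ β) refl _ q with x'' , refl , st' ← Step-++⁻ G (B ∷ β) y (λ ()) st =
      inj₂ (_ , x'' ++ z , q , Step-++ʳ G z st' , y⇒z x'' d)

  LM-≈-++ˡ : ∀ {R y z} → Dom D R → ∀ x → SuffixReplaceable R y z → SuffixReplaceable R z y →
             (Equiv D R y (x ++ y) → LM-≈ R y z) → LM-≈ R (x ++ y) (x ++ z)
  LM-≈-++ˡ dR x y⇒z z⇒y LM-y≈z =
      LM-⊆-++ˡ dR x y⇒z (λ e → proj₁ (LM-y≈z e))
    , LM-⊆-++ˡ dR x z⇒y (λ { (γ , d , d') → proj₂ (LM-y≈z (γ , z⇒y [] d , z⇒y x d')) })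

  module _ {R A R'} (dR : Dom D R) (p : Prime D R A) (r : IsRed D A R R') where

    private
      dR' : Dom D R'
      dR' = dom-red dR p r

    Equiv-∷ʳ⁺ : ∀ {u v} → Equiv D R' u v → Equiv D R (u ∷ʳ A) (v ∷ʳ A)
    Equiv-∷ʳ⁺ (γ , dᵤ , dᵥ) = γ ∷ʳ A , pd-prime p r dᵤ , pd-prime p r dᵥ

    Equiv-∷ʳ⁻ : ∀ {u v} → Equiv D R (u ∷ʳ A) (v ∷ʳ A) → Equiv D R' u v
    Equiv-∷ʳ⁻ (_ , dᵤ , dᵥ)
      with γᵤ , eqᵤ , dᵤ' ← PD-∷ʳ-prime⁻ p r dᵤ | γᵥ , eqᵥ , dᵥ' ← PD-∷ʳ-prime⁻ p r dᵥ
      with refl ← ∷ʳ-injectiveˡ γᵤ γᵥ (trans (sym eqᵤ) eqᵥ) = γᵥ , dᵤ' , dᵥ'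

    PresPath-∷ʳ⁺ : ∀ {α u} → PresPath G D R' α u → PresPath G D R (α ∷ʳ A) (u ∷ʳ A)
    PresPath-∷ʳ⁺ here           = here
    PresPath-∷ʳ⁺ (there q st e) = there (PresPath-∷ʳ⁺ q) (Step-++ʳ G [ A ] st) (Equiv-∷ʳ⁺ e)

    LM-∷ʳ⁺ : ∀ {α a η} → LM G D R' α a η → LM G D R (α ∷ʳ A) a (η ∷ʳ A)
    LM-∷ʳ⁺ (inj₁ (refl , d)) = inj₁ (refl , pd-prime p r d)
    LM-∷ʳ⁺ (inj₂ (u , α'' , q , st , d)) =
      inj₂ (u ∷ʳ A , α'' ∷ʳ A , PresPath-∷ʳ⁺ q , Step-++ʳ G [ A ] st , pd-prime p r d)

    -- Since PD_R'(α) ≠ ε, no state equivalent to α is empty, so the trailing A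
    -- is never consumed along a PD-preserving path from α A.
    module _ {α γ} (dα : PD D R' α γ) (γ≢[] : γ ≢ []) where

      private
        Equiv⇒≢[] : ∀ {u} → Equiv D R' u α → u ≢ []
        Equiv⇒≢[] (η , dᵤ , dα') refl with refl ← PD-[] dᵤ = γ≢[] (PD-functional dR' dα dα')

      PresPath-∷ʳ⁻ : ∀ {v} → PresPath G D R (α ∷ʳ A) v →
                     ∃ λ u → v ≡ u ∷ʳ A × Equiv D R' u α × PresPath G D R' α u
      PresPath-∷ʳ⁻ here = α , refl , (γ , dα , dα) , here
      PresPath-∷ʳ⁻ (there q st e)
        with u , refl , eᵤ , q' ← PresPath-∷ʳ⁻ q
        with u' , refl , st' ← Step-++⁻ G u [ A ] (Equiv⇒≢[] eᵤ) st =
        u' , refl , Equiv-∷ʳ⁻ e , there q' st' (Equiv-∷ʳ⁻ e)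

      LM-∷ʳ⁻ : ∀ {a α'} → LM G D R (α ∷ʳ A) a α' → ∃ λ η → α' ≡ η ∷ʳ A × LM G D R' α a η
      LM-∷ʳ⁻ (inj₁ (refl , d)) with η , refl , d' ← PD-∷ʳ-prime⁻ p r d = η , refl , inj₁ (refl , d')
      LM-∷ʳ⁻ (inj₂ (v , α'' , q , st , d))
        with u , refl , eᵤ , q' ← PresPath-∷ʳ⁻ q
        with u' , refl , st' ← Step-++⁻ G u [ A ] (Equiv⇒≢[] eᵤ) st
        with η , refl , d' ← PD-∷ʳ-prime⁻ p r d =
        η , refl , inj₂ (u , u' , q' , st' , d')

    LM-⊆-∷ʳ : ∀ {α β γ} → PD D R' α γ → γ ≢ [] → LM-⊆ R' α β → LM-⊆ R (α ∷ʳ A) (β ∷ʳ A)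
    LM-⊆-∷ʳ dα γ≢[] α⊆β l with _ , refl , l' ← LM-∷ʳ⁻ dα γ≢[] l = LM-∷ʳ⁺ (α⊆β l')

module Consistency {n m} {G : BPA n m} {D : PreBaseData n}
                   (base : IsBase G D) (consistent : Consistent G D) where
  pre : IsPreBase D
  pre = proj₁ base

  Bdec-fixed : ∀ A α R → (A , α , R) ∈ₗ Bdec D → PD D R α α
  Bdec-fixed = proj₂ (proj₂ base)

  open PD-Properties D
  open PD-Functional pre
  open PD-Total pre Bdec-fixed
  open LM-Properties G pre Bdec-fixed

  LM-≈-triple : ∀ {A δ R} → (A , δ , R) ∈ₗ (Bdec D ++ Bprop D) → LM-≈ R [ A ] δ
  LM-≈-triple t = (λ {a α'} → Equivalence.to (proj₂ (consistent _ _ _ t) a α'))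
                , (λ {a α'} → Equivalence.from (proj₂ (consistent _ _ _ t) a α'))

  LM-≈-reducible-prefix : ∀ {R A R'} → Dom D R → Prime D R A → IsRed D A R R' →
                          ∀ xs → All (_∈ R') xs → LM-≈ R (xs ++ [ A ]) [ A ]
  LM-≈-reducible-prefix dR p r []       []           = id , id
  LM-≈-reducible-prefix {R} {A} dR p r (X ∷ xs) (X∈R' ∷ xs⊆R') =
    LM-≈-trans (LM-≈-++ˡ dR [ X ] drop add (λ _ → LM-≈-reducible-prefix dR p r xs xs⊆R'))
               (LM-≈-sym (LM-≈-triple (∈-++⁺ʳ (Bdec D) (Equivalence.to (r X) X∈R'))))
    where
      drop : SuffixReplaceable R (xs ++ [ A ]) [ A ]
      drop x d with _ , refl , d' ← PD-∷ʳ-prime⁻ p r (PD-subst (sym (++-assoc x xs [ A ])) d) =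
        pd-prime p r (PD-++-∈⁻ xs⊆R' x d')
      add : SuffixReplaceable R [ A ] (xs ++ [ A ])
      add x d with _ , refl , d' ← PD-∷ʳ-prime⁻ p r d =
        PD-subst (++-assoc x xs [ A ]) (pd-prime p r (PD-++-∈⁺ xs⊆R' x d'))

  LM-≈-PD : ∀ {R α γ} → Dom D R → PD D R α γ → γ ≢ [] → LM-≈ R α γ
  LM-≈-PD dR pd-ε γ≢[] = ⊥-elim (γ≢[] refl)
  LM-≈-PD {R} dR (pd-in {β = β} {A = A} A∈R d) γ≢[] =
    LM-≈-trans (subst (LM-≈ R (β ∷ʳ A)) (++-identityʳ β) (LM-≈-++ˡ dR β drop add LM-[A]≈[]))
               (LM-≈-PD dR d γ≢[])
    where
      drop : SuffixReplaceable R [ A ] []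
      drop x d' = PD-subst (sym (++-identityʳ x)) (PD-∷ʳ-∈⁻ x A∈R d')
      add : SuffixReplaceable R [] [ A ]
      add x d' = pd-in A∈R (PD-subst (++-identityʳ x) d')
      LM-[A]≈[] : Equiv D R [ A ] (β ++ [ A ]) → LM-≈ R [ A ] []
      LM-[A]≈[] (η , dA , dβA) with refl ← PD-[] (PD-∷ʳ-∈⁻ [] A∈R dA) =
        ⊥-elim (γ≢[] (PD-functional dR (pd-in A∈R d) dβA))
  LM-≈-PD dR (pd-prime {β = β} {γ = []} p r d) _ =
    LM-≈-reducible-prefix dR p r β (PD≡[]⇒All∈ d refl)
  LM-≈-PD dR (pd-prime {γ = _ ∷ _} p r d) _ =
    let β⊆γ , γ⊆β = LM-≈-PD (dom-red dR p r) d (λ ()) in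
    LM-⊆-∷ʳ dR p r d (λ ()) β⊆γ , LM-⊆-∷ʳ dR p r (PD-idem d) (λ ()) γ⊆β
  LM-≈-PD {R} dR (pd-dec {β = β} {A = A} {α = δ} np t d) γ≢[] =
    LM-≈-trans (LM-≈-++ˡ dR β drop add (λ _ → LM-≈-triple (∈-++⁺ˡ t))) (LM-≈-PD dR d γ≢[])
    where
      drop : SuffixReplaceable R [ A ] δ
      drop x = PD-∷ʳ-nonPrime⁻ dR np t
      add : SuffixReplaceable R δ [ A ]
      add x = pd-dec np t

  PresPath⇒TauPath : ∀ {s t γ u} → PD D ∅ s γ → PD D ∅ t γ → PresPath G D ∅ t u →
                     TauPath G (EquivB G D) s t u
  PresPath⇒TauPath ds dt here           = here
  PresPath⇒TauPath ds dt (there q st e) =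
    there (PresPath⇒TauPath ds dt q) st (Equiv-trans dom-∅ (_ , ds , dt) (Equiv-sym e))

  PD-∅-≢[] : ∀ {s γ a s'} → PD D ∅ s γ → Step G s a s' → γ ≢ []
  PD-∅-≢[] d (step _) γ≡[] with A∈∅ ∷ _ ← PD≡[]⇒All∈ d γ≡[] = ∉⊥ A∈∅

  Equiv⇒LM-⊆ : ∀ {R s t γ} → Dom D R → PD D R s γ → PD D R t γ → γ ≢ [] → LM-⊆ R s t
  Equiv⇒LM-⊆ dR ds dt γ≢[] = proj₂ (LM-≈-PD dR dt γ≢[]) ∘ proj₁ (LM-≈-PD dR ds γ≢[])

  EquivB-transfer : ∀ s t → EquivB G D s t → ∀ a s' → Step G s a s' →
    (a ≡ τ × EquivB G D s' t) ⊎
    (∃₂ λ tk t' → TauPath G (EquivB G D) s t tk × Step G tk a t' × EquivB G D s' t')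
  EquivB-transfer s t (γ , ds , dt) a s' st
    with η , ds' ← PD-total dom-∅ s'
    with Equiv⇒LM-⊆ dom-∅ ds dt (PD-∅-≢[] ds st) (inj₂ (s , s' , here , st , ds'))
  ... | inj₁ (refl , dt') = inj₁ (refl , η , ds' , dt')
  ... | inj₂ (tk , t' , q , st' , dt') =
    inj₂ (tk , t' , PresPath⇒TauPath ds dt q , st' , η , ds' , dt')

lemma5 : ∀ {n m} (G : BPA n m) (D : PreBaseData n) →
    Normed G → NoSilentVariables G →
    IsBase G D → Consistent G D →
    IsBranchingBisimulation G (EquivB G D)
lemma5 G D _ _ base consistent = (λ _ _ → Equiv-sym) , EquivB-transfer
  where
    open PD-Properties D
    open Consistency base consistent
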